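{- Let $(F_n)$ be the Fibonacci numbers, $F_0=0$, $F_1=1$, $F_{n+2}=F_{n+1}+F_n$, extended by $F_{ -1}=F_1-F_0=1$, and let $(L_n)$ be the Lucas numbers, $L_0=2$, $L_1=1$, $L_{n+2}=L_{n+1}+L_n$. Then for every nonnegative integer $m$ and every real $c\neq0$, \[ c^{m+1}F_{m+1}=\sum_{i=0}^{m} c^{i}\left\{(c-1)F_{i+1}+F_{i-1}\right\}; \] in particular, for every nonnegative integer $m$, \[ 2^{m+1}F_{m+1}=\sum_{i=0}^{m}2^{i}L_{i} \qquad\text{and}\qquad 3^{m+1}F_{m+1}=\sum_{i=0}^{m}3^{i}L_{i}+\sum_{i=0}^{m+1}3^{i-1}F_{i}. \]
   Context: The term $F_{ -1}$ appearing for $i=0$ is defined by running the Fibonacci recurrence backward. -}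

module Defs where

open import Data.Nat using (ℕ; zero; suc)
import Data.Nat as ℕ
open import Algebra.Bundles using (CommutativeRing; Semiring)

fib : ℕ → ℕ
fib zero = 0
fib (suc zero) = 1
fib (suc (suc n)) = fib (suc n) ℕ.+ fib n

-- fibPrev i = F_{i-1}, with F_{-1} = F_1 - F_0 = 1 (recurrence run backward)
fibPrev : ℕ → ℕ
fibPrev zero = 1
fibPrev (suc i) = fib i

lucas : ℕ → ℕ
lucas zero = 2
lucas (suc zero) = 1
lucas (suc (suc n)) = lucas (suc n) ℕ.+ lucas n

sumTo : (ℕ → ℕ) → ℕ → ℕ
sumTo f zero = f zero
sumTo f (suc n) = sumTo f n ℕ.+ f (suc n)

module RingDefs {a ℓ} (R : CommutativeRing a ℓ) where
  open CommutativeRing R hiding (zero)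
  open import Algebra.Definitions.RawSemiring (Semiring.rawSemiring semiring) public using (_^_; _×_)

  ι : ℕ → Carrier
  ι n = n × 1#

  sumToR : (ℕ → Carrier) → ℕ → Carrier
  sumToR f zero = f zero
  sumToR f (suc n) = sumToR f n + f (suc n)

open import Relation.Nullary using (¬_)
open import Level using (_⊔_)

GeneralIdentity : ∀ {a ℓ} → CommutativeRing a ℓ → Set (a ⊔ ℓ)
GeneralIdentity R =
  (m : ℕ) (c : Carrier) → ¬ (c ≈ 0#) →
    (c ^ suc m) * ι (fib (suc m))
      ≈ sumToR (λ i → (c ^ i) * ((c - 1#) * ι (fib (suc i)) + ι (fibPrev i))) m
  where
  open CommutativeRing R hiding (zero)
  open RingDefs R

{-# OPTIONS --safe #-}
-- Since F_{i-1} + F_i = F_{i+1} (for i = 0 this is the choice F_{-1} = 1), the i-th summand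
-- equals c^{i+1} F_{i+1} − c^i F_i, so the sum telescopes down to c^{m+1} F_{m+1} − c^0 F_0.
-- Over ℕ, where there is no subtraction, the same telescoping is run for c = d + 1, and the
-- cases c = 2, 3 follow from L_i = F_{i+1} + F_{i-1}.
module Submission where

open import Defs
open import Level using (Level)
open import Data.Nat using (ℕ; zero; suc)
import Data.Nat as ℕ
open import Data.Nat.Properties using (+-comm)
open import Relation.Binary.PropositionalEquality using (_≡_; refl; cong)
open import Data.Nat.Solver using (module +-*-Solver)
open import Data.Product using (_×_; _,_)
open import Function using (_∘_)
open import Algebra.Bundles using (CommutativeRing)

fibPrev-+-fib : ∀ i → fibPrev i ℕ.+ fib i ≡ fib (suc i)
fibPrev-+-fib zero    = refl
fibPrev-+-fib (suc i) = +-comm (fib i) (fib (suc i))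

module _ {a ℓ} (R : CommutativeRing a ℓ) where
  open CommutativeRing R hiding (zero) renaming (refl to ≈-refl)
  open RingDefs R renaming (_^_ to _^ᴿ_)
  open import Algebra.Properties.Monoid.Mult +-monoid using (×-homo-+)
  open import Algebra.Solver.Ring.NaturalCoefficients.Default commutativeSemiring
  open import Relation.Binary.Reasoning.Setoid setoid

  sumToR-telescope : ∀ (f : ℕ → Carrier) {g} → f 0 ≈ 0# → (∀ i → f (suc i) ≈ f i + g i) →
                     ∀ m → f (suc m) ≈ sumToR g m
  sumToR-telescope f {g} f0≈0 step zero    = begin
    f 1          ≈⟨ step 0 ⟩
    f 0 + g 0    ≈⟨ +-congʳ f0≈0 ⟩
    0# + g 0     ≈⟨ +-identityˡ (g 0) ⟩
    g 0          ∎
  sumToR-telescope f {g} f0≈0 step (suc m) = trans (step (suc m)) (+-congʳ (sumToR-telescope f f0≈0 step m))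

  [x-1]*y+y≈x*y : ∀ x y → (x - 1#) * y + y ≈ x * y
  [x-1]*y+y≈x*y x y = begin
    (x - 1#) * y + y               ≈⟨ +-congˡ (sym (*-identityˡ y)) ⟩
    (x - 1#) * y + 1# * y          ≈⟨ sym (distribʳ y (x - 1#) 1#) ⟩
    ((x - 1#) + 1#) * y            ≈⟨ *-congʳ (+-assoc x (- 1#) 1#) ⟩
    (x + (- 1# + 1#)) * y          ≈⟨ *-congʳ (+-congˡ (-‿inverseˡ 1#)) ⟩
    (x + 0#) * y                   ≈⟨ *-congʳ (+-identityʳ x) ⟩
    x * y                          ∎

  generalIdentity : GeneralIdentity R
  generalIdentity m c _ = sumToR-telescope (λ i → (c ^ᴿ i) * ι (fib i)) (zeroʳ 1#) step m
    where
    step : ∀ i → (c ^ᴿ suc i) * ι (fib (suc i))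
               ≈ (c ^ᴿ i) * ι (fib i) + (c ^ᴿ i) * ((c - 1#) * ι (fib (suc i)) + ι (fibPrev i))
    step i = begin
      c * u * A                          ≈⟨ solve 3 (λ c u A → c :* u :* A := u :* (c :* A)) ≈-refl c u A ⟩
      u * (c * A)                        ≈⟨ *-congˡ (sym ([x-1]*y+y≈x*y c A)) ⟩
      u * ((c - 1#) * A + A)             ≈⟨ *-congˡ (+-congˡ A≈p+q) ⟩
      u * ((c - 1#) * A + (p + q))       ≈⟨ solve 5 (λ u t A p q → u :* (t :* A :+ (p :+ q))
                                                                := u :* q :+ u :* (t :* A :+ p))
                                                      ≈-refl u (c - 1#) A p q ⟩
      u * q + u * ((c - 1#) * A + p)     ∎
      where
      u = c ^ᴿ i
      A = ι (fib (suc i))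
      p = ι (fibPrev i)
      q = ι (fib i)
      A≈p+q : A ≈ p + q
      A≈p+q = trans (sym (reflexive (cong ι (fibPrev-+-fib i)))) (×-homo-+ 1# (fibPrev i) (fib i))

open import Data.Nat using (_+_; _*_; _^_; _∸_)
open import Relation.Binary.PropositionalEquality
  using (sym; trans; cong₂; module ≡-Reasoning)
open import Data.Nat.Properties using (+-assoc; *-identityˡ; *-distribˡ-+)

lucas≡fib+fibPrev : ∀ i → lucas i ≡ fib (suc i) + fibPrev i
lucas≡fib+fibPrev zero          = refl
lucas≡fib+fibPrev (suc zero)    = refl
lucas≡fib+fibPrev (suc (suc i)) = begin
  lucas (suc (suc i))                         ≡⟨ cong₂ _+_ (lucas≡fib+fibPrev (suc i)) (lucas≡fib+fibPrev i) ⟩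
  (b + a + a) + (b + p)                       ≡⟨ solve 3 (λ a b p → (b :+ a :+ a) :+ (b :+ p)
                                                                  := (b :+ a :+ b) :+ (p :+ a)) refl a b p ⟩
  (b + a + b) + (p + a)                       ≡⟨ cong (b + a + b +_) (fibPrev-+-fib i) ⟩
  fib (suc (suc (suc i))) + fib (suc i)       ∎
  where
  open ≡-Reasoning
  open +-*-Solver
  a = fib i
  b = fib (suc i)
  p = fibPrev i

sumTo-cong : ∀ {f g : ℕ → ℕ} → (∀ i → f i ≡ g i) → ∀ m → sumTo f m ≡ sumTo g m
sumTo-cong f≡g zero    = f≡g zero
sumTo-cong f≡g (suc m) = cong₂ _+_ (sumTo-cong f≡g m) (f≡g (suc m))

sumTo-distrib-+ : ∀ (f g : ℕ → ℕ) m → sumTo (λ i → f i + g i) m ≡ sumTo f m + sumTo g m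
sumTo-distrib-+ f g zero    = refl
sumTo-distrib-+ f g (suc m) = begin
  sumTo (λ i → f i + g i) m + (f (suc m) + g (suc m))   ≡⟨ cong (_+ (f (suc m) + g (suc m))) (sumTo-distrib-+ f g m) ⟩
  (sumTo f m + sumTo g m) + (f (suc m) + g (suc m))     ≡⟨ solve 4 (λ x y z w → (x :+ y) :+ (z :+ w)
                                                                            := (x :+ z) :+ (y :+ w))
                                                                    refl (sumTo f m) (sumTo g m) (f (suc m)) (g (suc m)) ⟩
  (sumTo f m + f (suc m)) + (sumTo g m + g (suc m))     ∎
  where
  open ≡-Reasoning
  open +-*-Solver

sumTo-shift : ∀ (f : ℕ → ℕ) m → sumTo f (suc m) ≡ f 0 + sumTo (f ∘ suc) m
sumTo-shift f zero    = refl
sumTo-shift f (suc m) = trans (cong (_+ f (suc (suc m))) (sumTo-shift f m))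
                              (+-assoc (f 0) (sumTo (f ∘ suc) m) (f (suc (suc m))))

sumTo-telescope : ∀ (f : ℕ → ℕ) {g} → f 0 ≡ 0 → (∀ i → f (suc i) ≡ f i + g i) →
                  ∀ m → f (suc m) ≡ sumTo g m
sumTo-telescope f {g} f0≡0 step zero    = trans (step 0) (cong (_+ g 0) f0≡0)
sumTo-telescope f {g} f0≡0 step (suc m) =
  trans (step (suc m)) (cong (_+ g (suc m)) (sumTo-telescope f f0≡0 step m))

geometric-fib-sum : ∀ d m → suc d ^ suc m * fib (suc m)
                          ≡ sumTo (λ i → suc d ^ i * (d * fib (suc i) + fibPrev i)) m
geometric-fib-sum d = sumTo-telescope (λ i → suc d ^ i * fib i) refl step
  where
  open ≡-Reasoning
  open +-*-Solver
  step : ∀ i → suc d ^ suc i * fib (suc i) ≡ suc d ^ i * fib i + suc d ^ i * (d * fib (suc i) + fibPrev i)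
  step i = begin
    suc d ^ suc i * fib (suc i)                       ≡⟨ cong (suc d ^ suc i *_) (sym (fibPrev-+-fib i)) ⟩
    suc d * u * (p + q)                               ≡⟨ solve 4 (λ d u p q → (con 1 :+ d) :* u :* (p :+ q)
                                                                         := u :* q :+ u :* (d :* (p :+ q) :+ p))
                                                                 refl d u p q ⟩
    u * q + u * (d * (p + q) + p)                     ≡⟨ cong (λ x → u * q + u * (d * x + p)) (fibPrev-+-fib i) ⟩
    u * fib i + u * (d * fib (suc i) + p)             ∎
    where
    u = suc d ^ i
    p = fibPrev i
    q = fib i

fib-sum-base2 : ∀ m → 2 ^ suc m * fib (suc m) ≡ sumTo (λ i → 2 ^ i * lucas i) m
fib-sum-base2 m = trans (geometric-fib-sum 1 m) (sumTo-cong (λ i → cong (2 ^ i *_) (summand i)) m)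
  where
  summand : ∀ i → 1 * fib (suc i) + fibPrev i ≡ lucas i
  summand i = trans (cong (_+ fibPrev i) (*-identityˡ (fib (suc i)))) (sym (lucas≡fib+fibPrev i))

fib-sum-base3 : ∀ m → 3 ^ suc m * fib (suc m)
              ≡ sumTo (λ i → 3 ^ i * lucas i) m + sumTo (λ i → 3 ^ (i ∸ 1) * fib i) (suc m)
fib-sum-base3 m = begin
  3 ^ suc m * fib (suc m)                                              ≡⟨ geometric-fib-sum 2 m ⟩
  sumTo (λ i → 3 ^ i * (2 * fib (suc i) + fibPrev i)) m                ≡⟨ sumTo-cong summand m ⟩
  sumTo (λ i → 3 ^ i * lucas i + 3 ^ i * fib (suc i)) m                ≡⟨ sumTo-distrib-+ _ _ m ⟩
  sumTo (λ i → 3 ^ i * lucas i) m + sumTo (λ i → 3 ^ i * fib (suc i)) m ≡⟨ cong (sumTo (λ i → 3 ^ i * lucas i) m +_)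
                                                                             (sym (sumTo-shift (λ i → 3 ^ (i ∸ 1) * fib i) m)) ⟩
  sumTo (λ i → 3 ^ i * lucas i) m + sumTo (λ i → 3 ^ (i ∸ 1) * fib i) (suc m) ∎
  where
  open ≡-Reasoning
  open +-*-Solver
  summand : ∀ i → 3 ^ i * (2 * fib (suc i) + fibPrev i) ≡ 3 ^ i * lucas i + 3 ^ i * fib (suc i)
  summand i = begin
    3 ^ i * (2 * fib (suc i) + fibPrev i)             ≡⟨ cong (3 ^ i *_) (solve 2 (λ f p → con 2 :* f :+ p := (f :+ p) :+ f)
                                                                                  refl (fib (suc i)) (fibPrev i)) ⟩
    3 ^ i * ((fib (suc i) + fibPrev i) + fib (suc i)) ≡⟨ cong (λ x → 3 ^ i * (x + fib (suc i))) (sym (lucas≡fib+fibPrev i)) ⟩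
    3 ^ i * (lucas i + fib (suc i))                   ≡⟨ *-distribˡ-+ (3 ^ i) (lucas i) (fib (suc i)) ⟩
    3 ^ i * lucas i + 3 ^ i * fib (suc i)             ∎

corollary1 : {a ℓ : Level} →
    ((R : CommutativeRing a ℓ) → GeneralIdentity R)
    × ((m : ℕ) → 2 ^ suc m * fib (suc m) ≡ sumTo (λ i → 2 ^ i * lucas i) m)
    × ((m : ℕ) → 3 ^ suc m * fib (suc m)
    ≡ sumTo (λ i → 3 ^ i * lucas i) m + sumTo (λ i → 3 ^ (i ∸ 1) * fib i) (suc m))
corollary1 = generalIdentity , fib-sum-base2 , fib-sum-base3
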